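{- Define the following classes of frames: $\mathcal{C}_{\mathbf{all}}$ is the class of all frames; $\mathcal{C}_{\mathbf{dox}}$ is the class of all doxastic frames; $\mathcal{C}_{\mathbf{epi}}$ is the class of all epistemic frames; $\mathcal{C}_{\mathbf{par}}$ is the class of all partitions. Let $\mathbf{L}_{\mathbf{all}}$ be the least intuitionistic modal logic. Let $\mathbf{L}_{\mathbf{dox}}$ be the least intuitionistic modal logic containing, for every group $\alpha$, the formula $p\rightarrow[\alpha]p$ (A6). Let $\mathbf{L}_{\mathbf{epi}}$ be the least intuitionistic modal logic containing, for every group $\alpha$, the formulas (A6) and $[\alpha]p\rightarrow\neg\neg\langle\alpha\rangle p$ (A7). Let $\mathbf{L}_{\mathbf{par}}$ be the least intuitionistic modal logic containing, for every group $\alpha$, the formulas $[\alpha]p\rightarrow p$, $p\rightarrow\langle\alpha\rangle p$, $p\rightarrow[\alpha]\langle\alpha\rangle p$ and $\langle\alpha\rangle[\alpha]p\rightarrow p$. Then: (1) $\mathbf{L}_{\mathbf{all}}=\mathtt{Log}(\mathcal{C}_{\mathbf{all}})$; (2) $\mathbf{L}_{\mathbf{dox}}=\mathtt{Log}(\mathcal{C}_{\mathbf{dox}})$; (3) $\mathbf{L}_{\mathbf{epi}}=\mathtt{Log}(\mathcal{C}_{\mathbf{epi}})$; (4) $\mathbf{L}_{\mathbf{par}}=\mathtt{Log}(\mathcal{C}_{\mathbf{par}})$.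
   Context: **Language.** Let $\mathbf{At}$ be a countably infinite set of atoms and let $\mathbf{Ag}$ be a finite set of agents. A group is a nonempty subset of $\mathbf{Ag}$. Formulas are generated by $$A ::= p \mid (A\rightarrow A) \mid \top \mid \bot \mid (A\vee A) \mid (A\wedge A) \mid [\alpha]A \mid \langle\alpha\rangle A,$$ where $p$ ranges over $\mathbf{At}$ and $\alpha$ ranges over groups. We write $\neg A$ for $A\rightarrow\bot$. **Frames.** A frame is a triple $(W,\leq,R)$ where $W$ is a nonempty set, $\leq$ is a preorder on $W$, and $R$ assigns to each group $\alpha$ a binary relation $R(\alpha)$ on $W$. For binary relations $S,T$, write $s\,(S\circ T)\,t$ iff there is $u$ with $sSu$ and $uTt$. Write $\geq$ for the converse of $\leq$. **Models and satisfaction.** A valuation on a frame is a map $V:\mathbf{At}\to\wp(W)$ such that each $V(p)$ is upward closed under $\leq$. A model is $(W,\leq,R,V)$, and satisfaction is defined as follows: - $s\models p$ iff $s\in V(p)$; - $s\models A\rightarrow B$ iff for all $t$ with $s\leq t$, either $t\not\models A$ or $t\models B$; - $s\models\top$, and $s\not\models\bot$; - $\vee$ and $\wedge$ are interpreted pointwise; - $s\models[\alpha]A$ iff for all $t$ with $s\,(\leq\circ R(\alpha))\,t$, $t\models A$; - $s\models\langle\alpha\rangle A$ iff there is $t$ with $s\,(\geq\circ R(\alpha))\,t$ and $t\models A$. A formula is valid in a frame if it is satisfied at every state of every model based on that frame. For a class $\mathcal{C}$ of frames, $\mathtt{Log}(\mathcal{C})$ is the set of formulas valid in every frame of $\mathcal{C}$.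 **Frame conditions.** - A frame is doxastic if for all groups $\alpha$ and all $s,t$, $sR(\alpha)t$ implies $s\leq t$. - A doxastic frame is epistemic if for every group $\alpha$ and every $s$ there is $t$ with $s\,(\leq\circ R(\alpha))\,t$. - A frame is a partition if every $R(\alpha)$ is reflexive, symmetric and transitive. **Logics.** An intuitionistic modal logic is a set of formulas that satisfies all of the following: - it is closed under uniform substitution; - it contains the standard axioms of intuitionistic propositional logic; - for every group $\alpha$, it contains - (A1) $[\alpha]p\wedge[\alpha]q\rightarrow[\alpha](p\wedge q)$, - (A2) $\langle\alpha\rangle(p\vee q)\rightarrow\langle\alpha\rangle p\vee\langle\alpha\rangle q$, - (A3) $[\alpha]\top$, - (A4) $\neg\langle\alpha\rangle\bot$, - (A5) $[\alpha](p\vee q)\rightarrow((\langle\alpha\rangle p\rightarrow[\alpha]q)\rightarrow[\alpha]q)$; - it is closed under modus ponens; - for every group $\alpha$, it is closed under the rules - from $p\rightarrow q$ infer $[\alpha]p\rightarrow[\alpha]q$, - from $p\rightarrow q$ infer $\langle\alpha\rangle p\rightarrow\langle\alpha\rangle q$, - from $\langle\alpha\rangle p\rightarrow q\vee[\alpha](p\rightarrow r)$ infer $\langle\alpha\rangle p\rightarrow q\vee\langle\alpha\rangle r$. "Least" means the intersection of all intuitionistic modal logics containing the listed formulas. -}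

module Defs where

open import Data.Nat using (ℕ)
open import Data.Fin.Subset using (Subset)
open import Data.Fin.Subset.Properties using (nonempty?)
open import Relation.Nullary.Decidable using (True)
open import Data.Product using (Σ; Σ-syntax; _×_; _,_)
open import Data.Sum using (_⊎_)
open import Data.Unit using () renaming (⊤ to 𝟙)
open import Data.Empty using () renaming (⊥ to 𝟘)
open import Relation.Binary.PropositionalEquality using (_≡_)

-- Atoms: ℕ (countably infinite).  Agents: Fin n (a finite set).
module WithAgents (n : ℕ) where

  -- A group is a nonempty subset of the agents.  Nonemptiness is recorded by
  -- the (proof-irrelevant) boolean test, so a group is determined by its subset.
  Group : Set
  Group = Σ[ S ∈ Subset n ] True (nonempty? S)

  infixr 5 _⇒_
  infixr 6 _∨_
  infixr 7 _∧_

  data Formula : Set where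
    var : ℕ → Formula
    _⇒_ : Formula → Formula → Formula
    ⊤ ⊥ : Formula
    _∨_ _∧_ : Formula → Formula → Formula
    [_]_ ⟨_⟩_ : Group → Formula → Formula

  ¬_ : Formula → Formula
  ¬ A = A ⇒ ⊥

  sub : (ℕ → Formula) → Formula → Formula
  sub σ (var x) = σ x
  sub σ (A ⇒ B) = sub σ A ⇒ sub σ B
  sub σ ⊤ = ⊤
  sub σ ⊥ = ⊥
  sub σ (A ∨ B) = sub σ A ∨ sub σ B
  sub σ (A ∧ B) = sub σ A ∧ sub σ B
  sub σ ([ α ] A) = [ α ] sub σ A
  sub σ (⟨ α ⟩ A) = ⟨ α ⟩ sub σ A

  p q r : Formula
  p = var 0
  q = var 1
  r = var 2

  -- standard Hilbert axioms of intuitionistic propositional logic (with atoms;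
  -- closure under uniform substitution yields all instances)
  data IPCAxiom : Formula → Set where
    ax-k : IPCAxiom (p ⇒ (q ⇒ p))
    ax-s : IPCAxiom ((p ⇒ (q ⇒ r)) ⇒ ((p ⇒ q) ⇒ (p ⇒ r)))
    ∧e₁ : IPCAxiom (p ∧ q ⇒ p)
    ∧e₂ : IPCAxiom (p ∧ q ⇒ q)
    ∧i  : IPCAxiom (p ⇒ (q ⇒ p ∧ q))
    ∨i₁ : IPCAxiom (p ⇒ p ∨ q)
    ∨i₂ : IPCAxiom (q ⇒ p ∨ q)
    ∨e  : IPCAxiom ((p ⇒ r) ⇒ ((q ⇒ r) ⇒ (p ∨ q ⇒ r)))
    ⊥e  : IPCAxiom (⊥ ⇒ p)
    ⊤i  : IPCAxiom ⊤

  data ModalAxiom : Formula → Set where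
    A1 : ∀ α → ModalAxiom ([ α ] p ∧ [ α ] q ⇒ [ α ] (p ∧ q))
    A2 : ∀ α → ModalAxiom (⟨ α ⟩ (p ∨ q) ⇒ ⟨ α ⟩ p ∨ ⟨ α ⟩ q)
    A3 : ∀ α → ModalAxiom ([ α ] ⊤)
    A4 : ∀ α → ModalAxiom (¬ ⟨ α ⟩ ⊥)
    A5 : ∀ α → ModalAxiom ([ α ] (p ∨ q) ⇒ ((⟨ α ⟩ p ⇒ [ α ] q) ⇒ [ α ] q))

  data Least (X : Formula → Set) : Formula → Set where
    extra  : ∀ {A} → X A → Least X A
    ipc    : ∀ {A} → IPCAxiom A → Least X A
    modal  : ∀ {A} → ModalAxiom A → Least X A
    subst  : ∀ {A} (σ : ℕ → Formula) → Least X A → Least X (sub σ A)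
    mp     : ∀ {A B} → Least X (A ⇒ B) → Least X A → Least X B
    mono□  : ∀ {A B} α → Least X (A ⇒ B) → Least X ([ α ] A ⇒ [ α ] B)
    mono◇  : ∀ {A B} α → Least X (A ⇒ B) → Least X (⟨ α ⟩ A ⇒ ⟨ α ⟩ B)
    rule◇  : ∀ {A B C} α → Least X (⟨ α ⟩ A ⇒ B ∨ [ α ] (A ⇒ C))
                         → Least X (⟨ α ⟩ A ⇒ B ∨ ⟨ α ⟩ C)

  data Xall : Formula → Set where

  data Xdox : Formula → Set where
    A6 : ∀ α → Xdox (p ⇒ [ α ] p)

  data Xepi : Formula → Set where
    A6 : ∀ α → Xepi (p ⇒ [ α ] p)
    A7 : ∀ α → Xepi ([ α ] p ⇒ ¬ ¬ ⟨ α ⟩ p)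

  data Xpar : Formula → Set where
    T□ : ∀ α → Xpar ([ α ] p ⇒ p)
    T◇ : ∀ α → Xpar (p ⇒ ⟨ α ⟩ p)
    B□ : ∀ α → Xpar (p ⇒ [ α ] ⟨ α ⟩ p)
    B◇ : ∀ α → Xpar (⟨ α ⟩ [ α ] p ⇒ p)

  Lall Ldox Lepi Lpar : Formula → Set
  Lall = Least Xall
  Ldox = Least Xdox
  Lepi = Least Xepi
  Lpar = Least Xpar

  record Frame : Set₁ where
    field
      W      : Set
      inhabited : W
      _≤_    : W → W → Set
      ≤-refl  : ∀ {s} → s ≤ s
      ≤-trans : ∀ {s t u} → s ≤ t → t ≤ u → s ≤ u
      R      : Group → W → W → Set

  module _ (F : Frame) where
    open Frame F

    record Valuation : Set₁ where
      field
        V     : ℕ → W → Set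
        upward : ∀ x {s t} → s ≤ t → V x s → V x t

    _,_⊨_ : Valuation → W → Formula → Set
    M , s ⊨ var x = Valuation.V M x s
    M , s ⊨ (A ⇒ B) = ∀ t → s ≤ t → M , t ⊨ A → M , t ⊨ B
    M , s ⊨ ⊤ = 𝟙
    M , s ⊨ ⊥ = 𝟘
    M , s ⊨ (A ∨ B) = (M , s ⊨ A) ⊎ (M , s ⊨ B)
    M , s ⊨ (A ∧ B) = (M , s ⊨ A) × (M , s ⊨ B)
    M , s ⊨ ([ α ] A) = ∀ u t → s ≤ u → R α u t → M , t ⊨ A
    M , s ⊨ (⟨ α ⟩ A) = Σ[ u ∈ W ] Σ[ t ∈ W ] (u ≤ s × R α u t × M , t ⊨ A)

    ValidIn : Formula → Set₁
    ValidIn A = ∀ (M : Valuation) (s : W) → M , s ⊨ A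

    Doxastic : Set
    Doxastic = ∀ α s t → R α s t → s ≤ t

    Epistemic : Set
    Epistemic = Doxastic × (∀ α s → Σ[ u ∈ W ] Σ[ t ∈ W ] (s ≤ u × R α u t))

    Partition : Set
    Partition = ∀ α → (∀ s → R α s s)
                    × (∀ s t → R α s t → R α t s)
                    × (∀ s t u → R α s t → R α t u → R α s u)

  Log : (Frame → Set) → Formula → Set₁
  Log C A = ∀ F → C F → ValidIn F A

  Call Cdox Cepi Cpar : Frame → Set
  Call _ = 𝟙
  Cdox = Doxastic
  Cepi = Epistemic
  Cpar = Partition

  _≐_ : (Formula → Set) → (Formula → Set₁) → Set₁
  L ≐ K = (∀ A → L A → K A) × (∀ A → K A → L A)

{-# OPTIONS --safe #-}

-- Completeness goes through the canonical
-- model: its worlds are prime theories ordered by inclusion, with w R_α v iff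
-- {A | [α]A ∈ w} ⊆ v ⊆ {A | ⟨α⟩A ∈ w}. Prime theories are built by Lindenbaum's construction
-- along an enumeration of the countably many formulas, excluded middle deciding each step.
-- In the truth lemma, [α]A ∉ w is witnessed by first extending w maximally without [α]A and
-- then using (A5). For ⟨α⟩A ∈ w one needs a prime theory u ⊆ w containing ⟨α⟩A in which
-- [α](A ⇒ C) forces ⟨α⟩C; it is built dually, by enlarging a set of rejected formulas, and
-- the rule from ⟨α⟩p → q ∨ [α](p → r) to ⟨α⟩p → q ∨ ⟨α⟩r is exactly what allows rejecting
-- [α](A ⇒ C) together with ⟨α⟩C. The extra axioms make the canonical frame doxastic,
-- epistemic, or reflexive and symmetric; a reflexive symmetric frame unravels into a
-- partition (states paired with a chosen successor for each group) with the same theory.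

module Submission where

open import Defs
open import Axiom.DoubleNegationElimination using (em⇒dne)
open import Axiom.ExcludedMiddle using (ExcludedMiddle)
open import Data.Bool using (Bool; true; false; T; if_then_else_)
open import Data.Bool.Properties using (T-irrelevant)
open import Data.Empty using (⊥-elim) renaming (⊥ to Empty)
open import Data.Maybe using (Maybe; just; nothing; zipWith) renaming (map to mapMaybe)
open import Data.Maybe.Properties using (just-injective)
open import Data.Nat using (ℕ; zero; suc; _*_)
open import Data.Nat.Properties using (even≢odd; *-cancelˡ-≡; suc-injective)
open import Data.Product using (∃; ∃₂; _×_; _,_; proj₁; proj₂)
open import Data.Product.Function.NonDependent.Propositional using (_×-⇔_)
open import Data.Sum using (_⊎_; inj₁; inj₂; [_,_]′)
import Data.Sum as Sum
open import Data.Sum.Function.Propositional using (_⊎-⇔_)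
open import Data.Unit using (tt) renaming (⊤ to Unit)
open import Data.Vec using (Vec; []; _∷_)
open import Function using (_∘_; id; case_of_)
open import Function.Bundles using (_↣_; mk↣; Injection; _⇔_; mk⇔; module Equivalence)
open import Function.Construct.Composition using (_↣-∘_)
open import Function.Construct.Identity using (↣-id; ⇔-id)
open import Level using (0ℓ)
open import Relation.Binary.Definitions using (DecidableEquality)
import Relation.Binary.PropositionalEquality as ≡
open import Relation.Binary.PropositionalEquality
  using (_≡_; refl; sym; trans; cong; cong₂; module ≡-Reasoning)
open import Relation.Nullary using (yes; no; does)
open import Relation.Nullary.Decidable using (isYes; toWitness; fromWitness)
open import Relation.Unary using (Pred; _∈_; _∉_; _⊆_; _⊆′_; _∪_; ∅; ｛_｝; ∁)

open Equivalence using (to; from)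

module Semantics (n : ℕ) (F : WithAgents.Frame n) where
  open WithAgents n hiding (_,_⊨_; ValidIn)
  open Frame F

  _,_⊨_ : Valuation F → W → Formula → Set
  _,_⊨_ = WithAgents._,_⊨_ n F

  Valid : Formula → Set₁
  Valid = WithAgents.ValidIn n F

  persistence : ∀ M A {s t} → s ≤ t → M , s ⊨ A → M , t ⊨ A
  persistence M (var x)   s≤t = Valuation.upward M x s≤t
  persistence M (A ⇒ B)   s≤t f = λ u t≤u → f u (≤-trans s≤t t≤u)
  persistence M ⊤         s≤t _ = tt
  persistence M ⊥         s≤t ()
  persistence M (A ∨ B)   s≤t (inj₁ a) = inj₁ (persistence M A s≤t a)
  persistence M (A ∨ B)   s≤t (inj₂ b) = inj₂ (persistence M B s≤t b)
  persistence M (A ∧ B)   s≤t (a , b)  = persistence M A s≤t a , persistence M B s≤t b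
  persistence M ([ α ] A) s≤t f = λ u v t≤u → f u v (≤-trans s≤t t≤u)
  persistence M (⟨ α ⟩ A) s≤t (u , v , u≤s , uRv , a) = u , v , ≤-trans u≤s s≤t , uRv , a

  infix 25 _[_]ᵛ
  _[_]ᵛ : Valuation F → (ℕ → Formula) → Valuation F
  M [ σ ]ᵛ = record { V = λ x s → M , s ⊨ σ x ; upward = λ x → persistence M (σ x) }

  substitution : ∀ M σ A {s} → M [ σ ]ᵛ , s ⊨ A ⇔ M , s ⊨ sub σ A
  substitution M σ (var x) = ⇔-id _
  substitution M σ (A ⇒ B) = mk⇔
    (λ f t s≤t a → to (substitution M σ B) (f t s≤t (from (substitution M σ A) a)))
    (λ f t s≤t a → from (substitution M σ B) (f t s≤t (to (substitution M σ A) a)))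
  substitution M σ ⊤ = ⇔-id _
  substitution M σ ⊥ = ⇔-id _
  substitution M σ (A ∨ B) = substitution M σ A ⊎-⇔ substitution M σ B
  substitution M σ (A ∧ B) = substitution M σ A ×-⇔ substitution M σ B
  substitution M σ ([ α ] A) = mk⇔
    (λ f u v s≤u uRv → to (substitution M σ A) (f u v s≤u uRv))
    (λ f u v s≤u uRv → from (substitution M σ A) (f u v s≤u uRv))
  substitution M σ (⟨ α ⟩ A) = mk⇔
    (λ (u , v , u≤s , uRv , a) → u , v , u≤s , uRv , to (substitution M σ A) a)
    (λ (u , v , u≤s , uRv , a) → u , v , u≤s , uRv , from (substitution M σ A) a)

  IPCAxiom-valid : ∀ {A} → IPCAxiom A → Valid A
  IPCAxiom-valid ax-k M s = λ t _ a u t≤u _ → persistence M p t≤u a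
  IPCAxiom-valid ax-s M s = λ t _ f u t≤u g v u≤v a →
    f v (≤-trans t≤u u≤v) a v ≤-refl (g v u≤v a)
  IPCAxiom-valid ∧e₁ M s = λ _ _ → proj₁
  IPCAxiom-valid ∧e₂ M s = λ _ _ → proj₂
  IPCAxiom-valid ∧i  M s = λ t _ a u t≤u b → persistence M p t≤u a , b
  IPCAxiom-valid ∨i₁ M s = λ _ _ → inj₁
  IPCAxiom-valid ∨i₂ M s = λ _ _ → inj₂
  IPCAxiom-valid ∨e  M s = λ t _ f u t≤u g v u≤v →
    [ f v (≤-trans t≤u u≤v) , g v u≤v ]′
  IPCAxiom-valid ⊥e  M s = λ _ _ ()
  IPCAxiom-valid ⊤i  M s = tt

  ModalAxiom-valid : ∀ {A} → ModalAxiom A → Valid A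
  ModalAxiom-valid (A1 α) M s = λ _ _ (f , g) u v t≤u uRv → f u v t≤u uRv , g u v t≤u uRv
  ModalAxiom-valid (A2 α) M s = λ where
    _ _ (u , v , u≤t , uRv , inj₁ a) → inj₁ (u , v , u≤t , uRv , a)
    _ _ (u , v , u≤t , uRv , inj₂ b) → inj₂ (u , v , u≤t , uRv , b)
  ModalAxiom-valid (A3 α) M s = λ _ _ _ _ → tt
  ModalAxiom-valid (A4 α) M s = λ where _ _ (_ , _ , _ , _ , ())
  ModalAxiom-valid (A5 α) M s = λ t _ f t′ t≤t′ g u v t′≤u uRv →
    [ (λ a → g u t′≤u (u , v , ≤-refl , uRv , a) u v ≤-refl uRv) , id ]′
      (f u v (≤-trans t≤t′ t′≤u) uRv)

  soundness : ∀ {X} → X ⊆ Valid → Least X ⊆ Valid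
  soundness X-valid (extra x) = X-valid x
  soundness X-valid (ipc ax) = IPCAxiom-valid ax
  soundness X-valid (modal ax) = ModalAxiom-valid ax
  soundness X-valid (subst {A} σ d) M s = to (substitution M σ A) (soundness X-valid d (M [ σ ]ᵛ) s)
  soundness X-valid (mp d e) M s = soundness X-valid d M s s ≤-refl (soundness X-valid e M s)
  soundness X-valid (mono□ α d) M s = λ _ _ f u v t≤u uRv →
    soundness X-valid d M v v ≤-refl (f u v t≤u uRv)
  soundness X-valid (mono◇ α d) M s = λ _ _ (u , v , u≤t , uRv , a) →
    u , v , u≤t , uRv , soundness X-valid d M v v ≤-refl a
  soundness X-valid (rule◇ {A} {B} α d) M s = λ t _ (u , v , u≤t , uRv , a) →
    [ inj₁ ∘ persistence M B u≤t , (λ f → inj₂ (u , v , u≤t , uRv , f u v ≤-refl uRv v ≤-refl a)) ]′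
      (soundness X-valid d M u u ≤-refl (u , v , ≤-refl , uRv , a))

  Xdox-valid : Doxastic F → Xdox ⊆ Valid
  Xdox-valid dox (A6 α) M s = λ _ _ a u v t≤u uRv → persistence M p (≤-trans t≤u (dox α u v uRv)) a

  Xepi-valid : Epistemic F → Xepi ⊆ Valid
  Xepi-valid (dox , serial) (A6 α) = Xdox-valid dox (A6 α)
  Xepi-valid (dox , serial) (A7 α) M s = λ t _ b t′ t≤t′ ¬◇p →
    let (u , v , t′≤u , uRv) = serial α t′
    in ¬◇p u t′≤u (u , v , ≤-refl , uRv , b u v (≤-trans t≤t′ t′≤u) uRv)

  Xpar-valid : Partition F → Xpar ⊆ Valid
  Xpar-valid par (T□ α) M s = λ t _ b → b t t ≤-refl (proj₁ (par α) t)
  Xpar-valid par (T◇ α) M s = λ t _ a → t , t , ≤-refl , proj₁ (par α) t , a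
  Xpar-valid par (B□ α) M s = λ t _ a u v t≤u uRv →
    v , u , ≤-refl , proj₁ (proj₂ (par α)) u v uRv , persistence M p t≤u a
  Xpar-valid par (B◇ α) M s = λ _ _ (u , v , u≤t , uRv , b) →
    persistence M p u≤t (b v u ≤-refl (proj₁ (proj₂ (par α)) u v uRv))

module Derivations (n : ℕ) (X : Pred (WithAgents.Formula n) 0ℓ) where
  open WithAgents n

  Formulas : Set₁
  Formulas = Pred Formula 0ℓ

  infix 3 ⊢_ _⊢_

  ⊢_ : Formulas
  ⊢_ = Least X

  data _⊢_ (Γ : Formulas) : Formula → Set where
    hyp : ∀ {A} → A ∈ Γ → Γ ⊢ A
    thm : ∀ {A} → ⊢ A → Γ ⊢ A
    mp  : ∀ {A B} → Γ ⊢ A ⇒ B → Γ ⊢ A → Γ ⊢ B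

  pqr↦ : Formula → Formula → Formula → ℕ → Formula
  pqr↦ A B C zero          = A
  pqr↦ A B C (suc zero)    = B
  pqr↦ A B C (suc (suc _)) = C

  ⊢-mono : ∀ {Γ Δ A} → Γ ⊆ Δ → Γ ⊢ A → Δ ⊢ A
  ⊢-mono Γ⊆Δ (hyp a)   = hyp (Γ⊆Δ a)
  ⊢-mono Γ⊆Δ (thm d)   = thm d
  ⊢-mono Γ⊆Δ (mp d e)  = mp (⊢-mono Γ⊆Δ d) (⊢-mono Γ⊆Δ e)

  ⊢-closed : ∀ {Γ A} → Γ ⊆ ⊢_ → Γ ⊢ A → ⊢ A
  ⊢-closed Γ⊆L (hyp a)  = Γ⊆L a
  ⊢-closed Γ⊆L (thm d)  = d
  ⊢-closed Γ⊆L (mp d e) = mp (⊢-closed Γ⊆L d) (⊢-closed Γ⊆L e)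

  module _ {Γ : Formulas} where

    ipc-axiom : ∀ {A} → IPCAxiom A → ∀ B C D → Γ ⊢ sub (pqr↦ B C D) A
    ipc-axiom ax B C D = thm (subst (pqr↦ B C D) (ipc ax))

    weaken : ∀ {A B} → Γ ⊢ A → Γ ∪ ｛ B ｝ ⊢ A
    weaken = ⊢-mono inj₁

    assumption : ∀ {A} → Γ ∪ ｛ A ｝ ⊢ A
    assumption = hyp (inj₂ refl)

    ⇒I : ∀ {A B} → Γ ∪ ｛ A ｝ ⊢ B → Γ ⊢ A ⇒ B
    ⇒I (hyp (inj₁ b))    = mp (ipc-axiom ax-k _ _ ⊤) (hyp b)
    ⇒I (hyp (inj₂ refl)) =
      mp (mp (ipc-axiom ax-s _ (_ ⇒ _) _) (ipc-axiom ax-k _ (_ ⇒ _) ⊤)) (ipc-axiom ax-k _ ⊤ ⊤)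
    ⇒I (thm d)           = mp (ipc-axiom ax-k _ _ ⊤) (thm d)
    ⇒I (mp d e)          = mp (mp (ipc-axiom ax-s _ _ _) (⇒I d)) (⇒I e)

    cut : ∀ {A B} → Γ ⊢ A → Γ ∪ ｛ A ｝ ⊢ B → Γ ⊢ B
    cut a d = mp (⇒I d) a

    ∧I : ∀ {A B} → Γ ⊢ A → Γ ⊢ B → Γ ⊢ A ∧ B
    ∧I a b = mp (mp (ipc-axiom ∧i _ _ ⊤) a) b

    ∧E₁ : ∀ {A B} → Γ ⊢ A ∧ B → Γ ⊢ A
    ∧E₁ = mp (ipc-axiom ∧e₁ _ _ ⊤)

    ∧E₂ : ∀ {A B} → Γ ⊢ A ∧ B → Γ ⊢ B
    ∧E₂ = mp (ipc-axiom ∧e₂ _ _ ⊤)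

    ∨I₁ : ∀ {A B} → Γ ⊢ A → Γ ⊢ A ∨ B
    ∨I₁ = mp (ipc-axiom ∨i₁ _ _ ⊤)

    ∨I₂ : ∀ {A B} → Γ ⊢ B → Γ ⊢ A ∨ B
    ∨I₂ = mp (ipc-axiom ∨i₂ _ _ ⊤)

    ∨E : ∀ {A B C} → Γ ⊢ A ∨ B → Γ ∪ ｛ A ｝ ⊢ C → Γ ∪ ｛ B ｝ ⊢ C → Γ ⊢ C
    ∨E d f g = mp (mp (mp (ipc-axiom ∨e _ _ _) (⇒I f)) (⇒I g)) d

    ⊥E : ∀ {A} → Γ ⊢ ⊥ → Γ ⊢ A
    ⊥E = mp (ipc-axiom ⊥e _ ⊤ ⊤)

    use : ∀ {A B} → ⊢ A ⇒ B → Γ ⊢ A → Γ ⊢ B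
    use f = mp (thm f)

  ⊢⇒I : ∀ {A B} → ∅ ∪ ｛ A ｝ ⊢ B → ⊢ A ⇒ B
  ⊢⇒I = ⊢-closed (λ ()) ∘ ⇒I

  ⊢⇒-trans : ∀ {A B C} → ⊢ A ⇒ B → ⊢ B ⇒ C → ⊢ A ⇒ C
  ⊢⇒-trans f g = ⊢⇒I (use g (use f assumption))

  ｛｝⊢⇒ : ∀ {A B} → ｛ A ｝ ⊢ B → ⊢ A ⇒ B
  ｛｝⊢⇒ = ⊢⇒I ∘ ⊢-mono inj₂

  ⊢⇒｛｝ : ∀ {A B} → ⊢ A ⇒ B → ｛ A ｝ ⊢ B
  ⊢⇒｛｝ f = use f (hyp refl)

  rule◇′ : ∀ {α A B C} → ⊢ ⟨ α ⟩ A ⇒ (B ∨ ⟨ α ⟩ C) ∨ [ α ] (A ⇒ C) → ⊢ ⟨ α ⟩ A ⇒ B ∨ ⟨ α ⟩ C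
  rule◇′ {α} d = ⊢⇒-trans (rule◇ α d) (⊢⇒I (∨E assumption assumption (∨I₂ assumption)))

  modal-axiom : ∀ {A} → ModalAxiom A → ∀ B C → ⊢ sub (pqr↦ B C ⊤) A
  modal-axiom ax B C = subst (pqr↦ B C ⊤) (modal ax)

  nec : ∀ {A} α → ⊢ A → ⊢ [ α ] A
  nec α d = mp (mono□ α (⊢⇒I (weaken (thm d)))) (modal (A3 α))

  □⁻¹ ◇⁻¹ : Group → Formulas → Formulas
  □⁻¹ α Δ A = [ α ] A ∈ Δ
  ◇⁻¹ α Δ A = ⟨ α ⟩ A ∈ Δ

  infixr 6 _∨ᵈ_

  data Disj (N : Formulas) : Formula → Set where
    elem : ∀ {A} → A ∈ N → Disj N A
    none : Disj N ⊥
    _∨ᵈ_ : ∀ {A B} → Disj N A → Disj N B → Disj N (A ∨ B)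

  Disj-mono : ∀ {N M D} → N ⊆ M → Disj N D → Disj M D
  Disj-mono N⊆M (elem a) = elem (N⊆M a)
  Disj-mono N⊆M none     = none
  Disj-mono N⊆M (d ∨ᵈ e) = Disj-mono N⊆M d ∨ᵈ Disj-mono N⊆M e

  Disj-｛｝ : ∀ {A D} → Disj ｛ A ｝ D → ⊢ D ⇒ A
  Disj-｛｝ (elem refl) = ⊢⇒I assumption
  Disj-｛｝ none        = ⊢⇒I (⊥E assumption)
  Disj-｛｝ (d ∨ᵈ e)    = ⊢⇒I (∨E assumption (use (Disj-｛｝ d) assumption) (use (Disj-｛｝ e) assumption))

  Disj-∪ : ∀ {N M D} → Disj (N ∪ M) D → ∃₂ λ E₁ E₂ → Disj N E₁ × Disj M E₂ × ⊢ D ⇒ E₁ ∨ E₂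
  Disj-∪ (elem (inj₁ a)) = _ , ⊥ , elem a , none , ⊢⇒I (∨I₁ assumption)
  Disj-∪ (elem (inj₂ a)) = ⊥ , _ , none , elem a , ⊢⇒I (∨I₂ assumption)
  Disj-∪ none            = ⊥ , ⊥ , none , none , ⊢⇒I (⊥E assumption)
  Disj-∪ (d ∨ᵈ e) with Disj-∪ d | Disj-∪ e
  ... | E₁ , E₂ , d₁ , d₂ , f | E₁′ , E₂′ , e₁ , e₂ , g =
    E₁ ∨ E₁′ , E₂ ∨ E₂′ , d₁ ∨ᵈ e₁ , d₂ ∨ᵈ e₂ ,
    ⊢⇒I (∨E assumption
      (∨E (use f assumption) (∨I₁ (∨I₁ assumption)) (∨I₂ (∨I₁ assumption)))
      (∨E (use g assumption) (∨I₁ (∨I₂ assumption)) (∨I₂ (∨I₂ assumption))))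

  Consistent : Formulas → Formulas → Set
  Consistent Γ N = ∀ {D} → Disj N D → Γ ⊢ D → Empty

  Consistent-antitone : ∀ {Γ Γ′ N N′} → Γ ⊆ Γ′ → N ⊆ N′ → Consistent Γ′ N′ → Consistent Γ N
  Consistent-antitone Γ⊆Γ′ N⊆N′ c d t = c (Disj-mono N⊆N′ d) (⊢-mono Γ⊆Γ′ t)

  ⊬⇒Consistent : ∀ {Γ A} → (Γ ⊢ A → Empty) → Consistent Γ ｛ A ｝
  ⊬⇒Consistent ⊬A d t = ⊬A (use (Disj-｛｝ d) t)

  record PrimeTheory (Δ : Formulas) : Set where
    field
      closed : ∀ {A} → Δ ⊢ A → A ∈ Δ
      ⊥∉     : ⊥ ∉ Δ
      prime  : ∀ {A B} → A ∨ B ∈ Δ → A ∈ Δ ⊎ B ∈ Δ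

    theorem∈ : ∀ {A} → ⊢ A → A ∈ Δ
    theorem∈ d = closed (thm d)

    ⊢⇒-closed : ∀ {A B} → ⊢ A ⇒ B → A ∈ Δ → B ∈ Δ
    ⊢⇒-closed f a = closed (use f (hyp a))

    ⇒-closed : ∀ {A B} → A ⇒ B ∈ Δ → A ∈ Δ → B ∈ Δ
    ⇒-closed f a = closed (mp (hyp f) (hyp a))

    Disj-∁ : ∀ {D} → Disj (∁ Δ) D → D ∉ Δ
    Disj-∁ (elem a)    = a
    Disj-∁ none        = ⊥∉
    Disj-∁ (d ∨ᵈ e) de = [ Disj-∁ d , Disj-∁ e ]′ (prime de)

    □-closed : ∀ {α A} → □⁻¹ α Δ ⊢ A → [ α ] A ∈ Δ
    □-closed (hyp a)  = a
    □-closed (thm d)  = theorem∈ (nec _ d)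
    □-closed {α} (mp d e) =
      ⊢⇒-closed (mono□ α (⊢⇒I (mp (∧E₁ assumption) (∧E₂ assumption))))
        (⊢⇒-closed (modal-axiom (A1 α) _ _) (closed (∧I (hyp (□-closed d)) (hyp (□-closed e)))))

    ◇-Disj : ∀ {α D} → Disj (∁ (◇⁻¹ α Δ)) D → ⟨ α ⟩ D ∉ Δ
    ◇-Disj (elem a)      = a
    ◇-Disj {α} none      = ⊥∉ ∘ ⊢⇒-closed (modal (A4 α))
    ◇-Disj {α} (d ∨ᵈ e)  = [ ◇-Disj d , ◇-Disj e ]′ ∘ prime ∘ ⊢⇒-closed (modal-axiom (A2 α) _ _)

  PrimeTheory-resp : ∀ {Δ Δ′} → Δ ⊆ Δ′ → Δ′ ⊆ Δ → PrimeTheory Δ → PrimeTheory Δ′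
  PrimeTheory-resp Δ⊆Δ′ Δ′⊆Δ p = record
    { closed = Δ⊆Δ′ ∘ closed ∘ ⊢-mono Δ′⊆Δ
    ; ⊥∉     = ⊥∉ ∘ Δ′⊆Δ
    ; prime  = Sum.map Δ⊆Δ′ Δ⊆Δ′ ∘ prime ∘ Δ′⊆Δ
    }
    where open PrimeTheory p

-- pair a b = 2ᵃ(2b + 1). Abstract, so that unification does not unfold it.
abstract
  pair : ℕ → ℕ → ℕ
  pair zero    b = suc (2 * b)
  pair (suc a) b = 2 * pair a b

  pair-injective : ∀ {a b c d} → pair a b ≡ pair c d → a ≡ c × b ≡ d
  pair-injective {zero}  {c = zero}  e = refl , *-cancelˡ-≡ _ _ 2 (suc-injective e)
  pair-injective {zero}  {b} {suc c} {d} e = ⊥-elim (even≢odd (pair c d) b (sym e))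
  pair-injective {suc a} {b} {zero}  {d} e = ⊥-elim (even≢odd (pair a b) d e)
  pair-injective {suc a} {b} {suc c} {d} e with pair-injective {a} {b} {c} {d} (*-cancelˡ-≡ _ _ 2 e)
  ... | refl , refl = refl , refl

module _ {A B : Set} where

  sum↣ℕ : A ↣ ℕ → B ↣ ℕ → (A ⊎ B) ↣ ℕ
  sum↣ℕ f g = mk↣ injective
    where
      open Injection f using () renaming (to to ⌜_⌝₁; injective to ⌜⌝₁-injective)
      open Injection g using () renaming (to to ⌜_⌝₂; injective to ⌜⌝₂-injective)
      ⌜_⌝ : A ⊎ B → ℕ
      ⌜ inj₁ a ⌝ = pair 0 ⌜ a ⌝₁
      ⌜ inj₂ b ⌝ = pair 1 ⌜ b ⌝₂
      injective : ∀ {x y} → ⌜ x ⌝ ≡ ⌜ y ⌝ → x ≡ y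
      injective {inj₁ _} {inj₁ _} e = cong inj₁ (⌜⌝₁-injective (proj₂ (pair-injective e)))
      injective {inj₁ _} {inj₂ _} e = case proj₁ (pair-injective e) of λ ()
      injective {inj₂ _} {inj₁ _} e = case proj₁ (pair-injective e) of λ ()
      injective {inj₂ _} {inj₂ _} e = cong inj₂ (⌜⌝₂-injective (proj₂ (pair-injective e)))

data Tree (A : Set) : Set where
  leaf : A → Tree A
  node : Tree A → Tree A → Tree A

module _ {A : Set} where

  tree↣ℕ : A ↣ ℕ → Tree A ↣ ℕ
  tree↣ℕ f = mk↣ injective
    where
      open Injection f using () renaming (to to ⌜_⌝ₗ; injective to ⌜⌝ₗ-injective)
      ⌜_⌝ : Tree A → ℕ
      ⌜ leaf a ⌝   = pair 0 ⌜ a ⌝ₗ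
      ⌜ node s t ⌝ = pair 1 (pair ⌜ s ⌝ ⌜ t ⌝)
      injective : ∀ {s t} → ⌜ s ⌝ ≡ ⌜ t ⌝ → s ≡ t
      injective {leaf _}   {leaf _}   e = cong leaf (⌜⌝ₗ-injective (proj₂ (pair-injective e)))
      injective {leaf _}   {node _ _} e = case proj₁ (pair-injective e) of λ ()
      injective {node _ _} {leaf _}   e = case proj₁ (pair-injective e) of λ ()
      injective {node _ _} {node _ _} e with pair-injective (proj₂ (pair-injective e))
      ... | e₁ , e₂ = cong₂ node (injective e₁) (injective e₂)

  vec↣ℕ : A ↣ ℕ → ∀ {m} → Vec A m ↣ ℕ
  vec↣ℕ f = mk↣ injective
    where
      open Injection f using () renaming (to to ⌜_⌝ₑ; injective to ⌜⌝ₑ-injective)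
      ⌜_⌝ : ∀ {m} → Vec A m → ℕ
      ⌜ [] ⌝    = 0
      ⌜ a ∷ v ⌝ = pair ⌜ a ⌝ₑ ⌜ v ⌝
      injective : ∀ {m} {u v : Vec A m} → ⌜ u ⌝ ≡ ⌜ v ⌝ → u ≡ v
      injective {u = []}    {[]}    e = refl
      injective {u = _ ∷ _} {_ ∷ _} e with pair-injective e
      ... | e₁ , e₂ = cong₂ _∷_ (⌜⌝ₑ-injective e₁) (injective e₂)

bool↣ℕ : Bool ↣ ℕ
bool↣ℕ = mk↣ injective
  where
    ⌜_⌝ : Bool → ℕ
    ⌜ false ⌝ = 0
    ⌜ true ⌝  = 1
    injective : ∀ {a b} → ⌜ a ⌝ ≡ ⌜ b ⌝ → a ≡ b
    injective {false} {false} _ = refl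
    injective {true}  {true}  _ = refl

module Countable (n : ℕ) where
  open WithAgents n

  group↣ℕ : Group ↣ ℕ
  group↣ℕ = vec↣ℕ bool↣ℕ ↣-∘ mk↣ proj₁-injective
    where
      proj₁-injective : ∀ {α β : Group} → proj₁ α ≡ proj₁ β → α ≡ β
      proj₁-injective {S , s} {.S , s′} refl = cong (S ,_) (T-irrelevant s s′)

  private
    pattern tag k = leaf (inj₁ k)
    pattern grp α = leaf (inj₂ α)

  ⌜_⌝ : Formula → Tree (ℕ ⊎ Group)
  ⌜ var x ⌝   = node (tag 0) (tag x)
  ⌜ A ⇒ B ⌝   = node (tag 1) (node ⌜ A ⌝ ⌜ B ⌝)
  ⌜ ⊤ ⌝       = tag 2
  ⌜ ⊥ ⌝       = tag 3
  ⌜ A ∨ B ⌝   = node (tag 4) (node ⌜ A ⌝ ⌜ B ⌝)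
  ⌜ A ∧ B ⌝   = node (tag 5) (node ⌜ A ⌝ ⌜ B ⌝)
  ⌜ [ α ] A ⌝ = node (tag 6) (node (grp α) ⌜ A ⌝)
  ⌜ ⟨ α ⟩ A ⌝ = node (tag 7) (node (grp α) ⌜ A ⌝)

  ⌞_⌟ : Tree (ℕ ⊎ Group) → Maybe Formula
  ⌞ node (tag 0) (tag x) ⌟           = just (var x)
  ⌞ node (tag 1) (node s t) ⌟       = zipWith _⇒_ ⌞ s ⌟ ⌞ t ⌟
  ⌞ tag 2 ⌟                         = just ⊤
  ⌞ tag 3 ⌟                         = just ⊥
  ⌞ node (tag 4) (node s t) ⌟       = zipWith _∨_ ⌞ s ⌟ ⌞ t ⌟
  ⌞ node (tag 5) (node s t) ⌟       = zipWith _∧_ ⌞ s ⌟ ⌞ t ⌟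
  ⌞ node (tag 6) (node (grp α) t) ⌟ = mapMaybe ([ α ]_) ⌞ t ⌟
  ⌞ node (tag 7) (node (grp α) t) ⌟ = mapMaybe (⟨ α ⟩_) ⌞ t ⌟
  ⌞ _ ⌟                             = nothing

  ⌞⌜_⌝⌟ : ∀ A → ⌞ ⌜ A ⌝ ⌟ ≡ just A
  ⌞⌜ var x ⌝⌟                             = refl
  ⌞⌜ A ⇒ B ⌝⌟   rewrite ⌞⌜ A ⌝⌟ | ⌞⌜ B ⌝⌟ = refl
  ⌞⌜ ⊤ ⌝⌟                                 = refl
  ⌞⌜ ⊥ ⌝⌟                                 = refl
  ⌞⌜ A ∨ B ⌝⌟   rewrite ⌞⌜ A ⌝⌟ | ⌞⌜ B ⌝⌟ = refl
  ⌞⌜ A ∧ B ⌝⌟   rewrite ⌞⌜ A ⌝⌟ | ⌞⌜ B ⌝⌟ = refl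
  ⌞⌜ [ α ] A ⌝⌟ rewrite ⌞⌜ A ⌝⌟           = refl
  ⌞⌜ ⟨ α ⟩ A ⌝⌟ rewrite ⌞⌜ A ⌝⌟           = refl

  formula↣ℕ : Formula ↣ ℕ
  formula↣ℕ = tree↣ℕ (sum↣ℕ (↣-id ℕ) group↣ℕ) ↣-∘ mk↣ ⌜⌝-injective
    where
      ⌜⌝-injective : ∀ {A B} → ⌜ A ⌝ ≡ ⌜ B ⌝ → A ≡ B
      ⌜⌝-injective {A} {B} e = just-injective (begin
        just A     ≡⟨ sym ⌞⌜ A ⌝⌟ ⟩
        ⌞ ⌜ A ⌝ ⌟  ≡⟨ cong ⌞_⌟ e ⟩
        ⌞ ⌜ B ⌝ ⌟  ≡⟨ ⌞⌜ B ⌝⌟ ⟩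
        just B     ∎)
        where open ≡-Reasoning

module Lindenbaum (n : ℕ) (lem : ExcludedMiddle 0ℓ) (X : Pred (WithAgents.Formula n) 0ℓ) where
  open import Data.Nat using (_≤_; _⊔_; _≤′_; ≤′-refl; ≤′-step)
  open import Data.Nat.Properties using (≤⇒≤′; m≤m⊔n; m≤n⊔m)
  open WithAgents n
  open Derivations n X
  open Injection (Countable.formula↣ℕ n) using () renaming (to to code; injective to code-injective)

  enum : ℕ → Formula
  enum i with lem {∃ λ A → code A ≡ i}
  ... | yes (A , _) = A
  ... | no _        = ⊥

  enum-surjective : ∀ A → ∃ λ i → enum i ≡ A
  enum-surjective A = code A , enum-code
    where
      enum-code : enum (code A) ≡ A
      enum-code with lem {∃ λ B → code B ≡ code A}
      ... | yes (B , e) = code-injective e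
      ... | no ∄B       = ⊥-elim (∄B (A , refl))

  ¬Consistent-witness : ∀ {Γ N} → (Consistent Γ N → Empty) → ∃ λ D → Disj N D × Γ ⊢ D
  ¬Consistent-witness {Γ} {N} ¬c with lem {∃ λ D → Disj N D × Γ ⊢ D}
  ... | yes w = w
  ... | no ∄w = ⊥-elim (¬c (λ d t → ∄w (_ , d , t)))

  ⋃ : (ℕ → Formulas) → Formulas
  ⋃ S A = ∃ λ i → A ∈ S i

  Increasing : (ℕ → Formulas) → Set
  Increasing S = ∀ {i} → S i ⊆ S (suc i)

  module _ {S : ℕ → Formulas} (S-increasing : Increasing S) where

    Increasing-≤ : ∀ {i j} → i ≤ j → S i ⊆ S j
    Increasing-≤ = go ∘ ≤⇒≤′
      where
        go : ∀ {i j} → i ≤′ j → S i ⊆ S j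
        go ≤′-refl       a = a
        go (≤′-step i≤j) a = S-increasing (go i≤j a)

    ⊢-compact : ∀ {A} → ⋃ S ⊢ A → ∃ λ i → S i ⊢ A
    ⊢-compact (hyp (i , a)) = i , hyp a
    ⊢-compact (thm d)       = 0 , thm d
    ⊢-compact (mp d e) with ⊢-compact d | ⊢-compact e
    ... | i , d′ | j , e′ =
      i ⊔ j , mp (⊢-mono (Increasing-≤ (m≤m⊔n i j)) d′) (⊢-mono (Increasing-≤ (m≤n⊔m i j)) e′)

    Disj-compact : ∀ {D} → Disj (⋃ S) D → ∃ λ i → Disj (S i) D
    Disj-compact (elem (i , a)) = i , elem a
    Disj-compact none           = 0 , none
    Disj-compact (d ∨ᵈ e) with Disj-compact d | Disj-compact e
    ... | i , d′ | j , e′ =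
      i ⊔ j , Disj-mono (Increasing-≤ (m≤m⊔n i j)) d′ ∨ᵈ Disj-mono (Increasing-≤ (m≤n⊔m i j)) e′

  Consistent-⋃ : ∀ {Γ N} → Increasing Γ → Increasing N →
                 (∀ i → Consistent (Γ i) (N i)) → Consistent (⋃ Γ) (⋃ N)
  Consistent-⋃ {Γ} {N} Γ-inc N-inc c d t with Disj-compact N-inc d | ⊢-compact Γ-inc t
  ... | i , d′ | j , t′ = c (i ⊔ j)
    (Disj-mono (Increasing-≤ {N} N-inc (m≤m⊔n i j)) d′) (⊢-mono (Increasing-≤ {Γ} Γ-inc (m≤n⊔m i j)) t′)

  record PrimeExtension (Γ N : Formulas) : Set₁ where
    field
      theory     : Formulas
      isPrime    : PrimeTheory theory
      extends    : Γ ⊆ theory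
      consistent : Consistent theory N
      maximal    : ∀ {A} → A ∉ theory → ∃ λ D → Disj N D × theory ∪ ｛ A ｝ ⊢ D

  module LindenbaumConstruction {Γ N : Formulas} (Γ,N-consistent : Consistent Γ N) where

    stage : ℕ → Formulas
    stage zero    = Γ
    stage (suc i) = stage i ∪ λ A → enum i ≡ A × Consistent (stage i ∪ ｛ enum i ｝) N

    stage-consistent : ∀ i → Consistent (stage i) N
    stage-consistent zero = Γ,N-consistent
    stage-consistent (suc i) with lem {Consistent (stage i ∪ ｛ enum i ｝) N}
    ... | yes c = Consistent-antitone [ inj₁ , inj₂ ∘ proj₁ ]′ id c
    ... | no ¬c = Consistent-antitone [ id , ⊥-elim ∘ ¬c ∘ proj₂ ]′ id (stage-consistent i)

    Δ : Formulas
    Δ = ⋃ stage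

    Δ-consistent : Consistent Δ N
    Δ-consistent =
      Consistent-antitone id (0 ,_) (Consistent-⋃ {stage} {λ _ → N} inj₁ id stage-consistent)

    Δ-maximal : ∀ {A} → A ∉ Δ → ∃ λ D → Disj N D × Δ ∪ ｛ A ｝ ⊢ D
    Δ-maximal {A} A∉ = ¬Consistent-witness λ c →
      let i , enum-i≡A = enum-surjective A
          c′ = Consistent-antitone [ inj₁ ∘ (i ,_) , inj₂ ∘ trans (sym enum-i≡A) ]′ id c
      in A∉ (suc i , inj₂ (enum-i≡A , c′))

    Δ-prime : PrimeTheory Δ
    Δ-prime = record { closed = closed ; ⊥∉ = Δ-consistent none ∘ hyp ; prime = prime }
      where
        closed : ∀ {A} → Δ ⊢ A → A ∈ Δ
        closed {A} d with lem {A ∈ Δ}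
        ... | yes A∈ = A∈
        ... | no A∉  = let D , δ , t = Δ-maximal A∉ in ⊥-elim (Δ-consistent δ (cut d t))

        prime : ∀ {A B} → A ∨ B ∈ Δ → A ∈ Δ ⊎ B ∈ Δ
        prime {A} {B} A∨B∈ with lem {A ∈ Δ} | lem {B ∈ Δ}
        ... | yes A∈ | _      = inj₁ A∈
        ... | no _   | yes B∈ = inj₂ B∈
        ... | no A∉  | no B∉  =
          let D₁ , δ₁ , t₁ = Δ-maximal A∉
              D₂ , δ₂ , t₂ = Δ-maximal B∉
          in ⊥-elim (Δ-consistent (δ₁ ∨ᵈ δ₂) (∨E (hyp A∨B∈) (∨I₁ t₁) (∨I₂ t₂)))

  lindenbaum : ∀ {Γ N} → Consistent Γ N → PrimeExtension Γ N
  lindenbaum c = record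
    { theory = Δ ; isPrime = Δ-prime ; extends = 0 ,_ ; consistent = Δ-consistent ; maximal = Δ-maximal }
    where open LindenbaumConstruction c

  record CompanionClosedExtension (Γ N : Formulas) (companion : Formula → Formulas) : Set₁ where
    field
      theory           : Formulas
      isPrime          : PrimeTheory theory
      extends          : Γ ⊆ theory
      disjoint         : theory ⊆ ∁ N
      companion-closed : ∀ {A B} → B ∈ companion A → B ∈ theory → A ∈ theory

  module DualConstruction {Γ N : Formulas} (companion : Formula → Formulas)
    (companion-consistent : ∀ {M A} → Consistent Γ (M ∪ ｛ A ｝) →
                                      Consistent Γ (M ∪ (｛ A ｝ ∪ companion A)))
    (Γ,N-consistent : Consistent Γ N) where

    stage : ℕ → Formulas
    stage zero    = N
    stage (suc i) = stage i ∪ λ A →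
      (｛ enum i ｝ ∪ companion (enum i)) A × Consistent Γ (stage i ∪ ｛ enum i ｝)

    stage-consistent : ∀ i → Consistent Γ (stage i)
    stage-consistent zero = Γ,N-consistent
    stage-consistent (suc i) with lem {Consistent Γ (stage i ∪ ｛ enum i ｝)}
    ... | yes c = Consistent-antitone id [ inj₁ , inj₂ ∘ proj₁ ]′ (companion-consistent c)
    ... | no ¬c = Consistent-antitone id [ id , ⊥-elim ∘ ¬c ∘ proj₂ ]′ (stage-consistent i)

    rejected : Formulas
    rejected = ⋃ stage

    rejected-consistent : Consistent Γ rejected
    rejected-consistent =
      Consistent-antitone (0 ,_) id (Consistent-⋃ {λ _ → Γ} {stage} id inj₁ stage-consistent)

    rejected-maximal : ∀ {A} → Consistent Γ (rejected ∪ ｛ A ｝) → ｛ A ｝ ∪ companion A ⊆ rejected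
    rejected-maximal {A} c {B} B∈ with enum-surjective A
    ... | i , refl = suc i , inj₂ (B∈ , Consistent-antitone id [ inj₁ ∘ (i ,_) , inj₂ ]′ c)

    forced : ∀ {A} → A ∉ rejected → ∃ λ E → Disj rejected E × Γ ⊢ E ∨ A
    forced A∉ =
      let D , δ , t = ¬Consistent-witness (λ c → A∉ (rejected-maximal c (inj₁ refl)))
          E₁ , E₂ , δ₁ , δ₂ , f = Disj-∪ δ
      in E₁ , δ₁ , ∨E (use f t) (∨I₁ assumption) (∨I₂ (use (Disj-｛｝ δ₂) assumption))

    ⊢-forced : ∀ {A} → ∁ rejected ⊢ A → ∃ λ E → Disj rejected E × Γ ⊢ E ∨ A
    ⊢-forced (hyp A∉) = forced A∉
    ⊢-forced (thm d)  = ⊥ , none , ∨I₂ (thm d)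
    ⊢-forced (mp d e) with ⊢-forced d | ⊢-forced e
    ... | E₁ , δ₁ , t₁ | E₂ , δ₂ , t₂ = E₁ ∨ E₂ , δ₁ ∨ᵈ δ₂ ,
      ∨E t₁ (∨I₁ (∨I₁ assumption))
            (∨E (weaken t₂) (∨I₁ (∨I₂ assumption)) (∨I₂ (mp (weaken assumption) assumption)))

    ∁rejected-prime : PrimeTheory (∁ rejected)
    ∁rejected-prime = record { closed = closed ; ⊥∉ = ⊥∉ ; prime = prime }
      where
        closed : ∀ {A} → ∁ rejected ⊢ A → A ∉ rejected
        closed d A∈ = let E , δ , t = ⊢-forced d in rejected-consistent (δ ∨ᵈ elem A∈) t

        ⊥∉ : ⊥ ∉ ∁ rejected
        ⊥∉ ⊥∉rejected = let E , δ , t = forced ⊥∉rejected in rejected-consistent (δ ∨ᵈ none) t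

        prime : ∀ {A B} → A ∨ B ∉ rejected → A ∉ rejected ⊎ B ∉ rejected
        prime {A} {B} A∨B∉ with lem {A ∈ rejected} | lem {B ∈ rejected}
        ... | no A∉  | _      = inj₁ A∉
        ... | yes _  | no B∉  = inj₂ B∉
        ... | yes A∈ | yes B∈ =
          let E , δ , t = forced A∨B∉ in ⊥-elim (rejected-consistent (δ ∨ᵈ elem A∈ ∨ᵈ elem B∈) t)

    ∁rejected-companion-closed : ∀ {A B} → B ∈ companion A → B ∉ rejected → A ∉ rejected
    ∁rejected-companion-closed b B∉ A∈ =
      B∉ (rejected-maximal (Consistent-antitone id [ id , (λ { refl → A∈ }) ]′ rejected-consistent)
                           (inj₂ b))

  dual-lindenbaum : ∀ {Γ N} (companion : Formula → Formulas) →
    (∀ {M A} → Consistent Γ (M ∪ ｛ A ｝) → Consistent Γ (M ∪ (｛ A ｝ ∪ companion A))) →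
    Consistent Γ N → CompanionClosedExtension Γ N companion
  dual-lindenbaum companion companion-consistent c = record
    { theory           = ∁ rejected
    ; isPrime          = ∁rejected-prime
    ; extends          = λ A∈Γ A∈ → rejected-consistent (elem A∈) (hyp A∈Γ)
    ; disjoint         = λ A∉ A∈N → A∉ (0 , A∈N)
    ; companion-closed = ∁rejected-companion-closed
    }
    where open DualConstruction companion companion-consistent c

module Canonical (n : ℕ) (lem : ExcludedMiddle 0ℓ) (X : Pred (WithAgents.Formula n) 0ℓ)
                 (⊬⊥ : WithAgents.Least n X WithAgents.⊥ → Empty) where
  open WithAgents n hiding (_,_⊨_; ValidIn)
  open Derivations n X
  open Lindenbaum n lem X
  -- Membership is Bool-valued (decided by excluded middle) so that World lives in Set.
  record World : Set where
    field
      member  : Formula → Bool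
      isPrime : PrimeTheory (T ∘ member)
    open PrimeTheory isPrime public

  ⟦_⟧ : World → Formulas
  ⟦ w ⟧ = T ∘ World.member w

  world : ∀ {Δ} → PrimeTheory Δ → World
  world {Δ} p = record
    { member  = λ A → isYes (lem {A ∈ Δ})
    ; isPrime = PrimeTheory-resp fromWitness toWitness p
    }

  ⟦world⟧⊆ : ∀ {Δ} (p : PrimeTheory Δ) → ⟦ world p ⟧ ⊆ Δ
  ⟦world⟧⊆ p = toWitness

  ⊆⟦world⟧ : ∀ {Δ} (p : PrimeTheory Δ) → Δ ⊆ ⟦ world p ⟧
  ⊆⟦world⟧ p = fromWitness

  open PrimeExtension using (theory; isPrime; extends; consistent; maximal)

  dne : ∀ {P : Set} → ((P → Empty) → Empty) → P
  dne = em⇒dne lem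

  Rᶜ : Group → Formulas → Formulas → Set
  Rᶜ α Δ Δ′ = □⁻¹ α Δ ⊆ Δ′ × Δ′ ⊆ ◇⁻¹ α Δ

  Rᶜ-world : ∀ {α Δ Δ′} (p : PrimeTheory Δ) (p′ : PrimeTheory Δ′) →
             Rᶜ α Δ Δ′ → Rᶜ α ⟦ world p ⟧ ⟦ world p′ ⟧
  Rᶜ-world p p′ (□Δ⊆Δ′ , Δ′⊆◇Δ) =
    ⊆⟦world⟧ p′ ∘ □Δ⊆Δ′ ∘ ⟦world⟧⊆ p , ⊆⟦world⟧ p ∘ Δ′⊆◇Δ ∘ ⟦world⟧⊆ p′

  Rᶜ-extension : ∀ {α Δ Γ N} → □⁻¹ α Δ ⊆ Γ → ∁ (◇⁻¹ α Δ) ⊆ N →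
                 (e : PrimeExtension Γ N) → Rᶜ α Δ (theory e)
  Rᶜ-extension □Δ⊆Γ ∁◇Δ⊆N e =
    extends e ∘ □Δ⊆Γ , λ A∈ → dne λ ◇A∉ → consistent e (elem (∁◇Δ⊆N ◇A∉)) (hyp A∈)

  □-successor-consistent : ∀ {Δ α A} (e : PrimeExtension Δ ｛ [ α ] A ｝) →
    Consistent (□⁻¹ α (theory e)) (｛ A ｝ ∪ ∁ (◇⁻¹ α (theory e)))
  □-successor-consistent {α = α} {A} e δ t =
    let E₁ , E₂ , δ₁ , δ₂ , f = Disj-∪ δ
        □[E₂∨A]∈ = □-closed (∨E (use f t) (∨I₂ (use (Disj-｛｝ δ₁) assumption)) (∨I₁ assumption))
        D , δ′ , t′ = maximal e (◇-Disj δ₂)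
        ◇E₂⇒□A∈ = closed (⇒I (use (Disj-｛｝ δ′) t′))
    in consistent e (elem refl) (hyp (⇒-closed (⊢⇒-closed (modal-axiom (A5 α) E₂ A) □[E₂∨A]∈) ◇E₂⇒□A∈))
    where open PrimeTheory (isPrime e)

  ◇-successor-consistent : ∀ {Δ α A} → PrimeTheory Δ →
    (∀ {C} → [ α ] (A ⇒ C) ∈ Δ → ⟨ α ⟩ C ∈ Δ) →
    Consistent (□⁻¹ α Δ ∪ ｛ A ｝) (∁ (◇⁻¹ α Δ))
  ◇-successor-consistent p □[A⇒C]⇒◇C δ t = ◇-Disj δ (□[A⇒C]⇒◇C (□-closed (⇒I t)))
    where open PrimeTheory p

  -- Whenever the dual construction rejects ⟨ α ⟩ D it also rejects [ α ] (A ⇒ D), which is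
  -- harmless by rule◇′; the resulting theory then satisfies [ α ] (A ⇒ D) → ⟨ α ⟩ D.
  ◇-companion : Group → Formula → Formula → Formulas
  ◇-companion α A B C = ∃ λ D → B ≡ ⟨ α ⟩ D × C ≡ [ α ] (A ⇒ D)

  ◇-companion-consistent : ∀ {α A M B} → Consistent ｛ ⟨ α ⟩ A ｝ (M ∪ ｛ B ｝) →
    Consistent ｛ ⟨ α ⟩ A ｝ (M ∪ (｛ B ｝ ∪ ◇-companion α A B))
  ◇-companion-consistent {α} {A} {M} {B} c δ t with Disj-∪ δ | lem {∃ λ D → B ≡ ⟨ α ⟩ D}
  ... | E₁ , E₂ , δ₁ , δ₂ , f | yes (D , refl) =
    c (Disj-mono inj₁ δ₁ ∨ᵈ elem (inj₂ refl)) (⊢⇒｛｝ (rule◇′ (⊢⇒-trans (｛｝⊢⇒ (use f t)) regroup)))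
    where
      only-□[A⇒D] : ｛ ⟨ α ⟩ D ｝ ∪ ◇-companion α A (⟨ α ⟩ D) ⊆ ｛ ⟨ α ⟩ D ｝ ∪ ｛ [ α ] (A ⇒ D) ｝
      only-□[A⇒D] (inj₁ e)               = inj₁ e
      only-□[A⇒D] (inj₂ (_ , refl , e)) = inj₂ (sym e)
      regroup : ⊢ E₁ ∨ E₂ ⇒ (E₁ ∨ ⟨ α ⟩ D) ∨ [ α ] (A ⇒ D)
      regroup =
        let F₁ , F₂ , ε₁ , ε₂ , g = Disj-∪ (Disj-mono only-□[A⇒D] δ₂)
        in ⊢⇒I (∨E assumption (∨I₁ (∨I₁ assumption))
                 (∨E (use g assumption) (∨I₁ (∨I₂ (use (Disj-｛｝ ε₁) assumption)))
                                        (∨I₂ (use (Disj-｛｝ ε₂) assumption))))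
  ... | E₁ , E₂ , δ₁ , δ₂ , f | no ∄D =
    c (Disj-mono inj₁ δ₁ ∨ᵈ elem (inj₂ refl))
      (∨E (use f t) (∨I₁ assumption) (∨I₂ (use (Disj-｛｝ (Disj-mono only-B δ₂)) assumption)))
    where
      only-B : ｛ B ｝ ∪ ◇-companion α A B ⊆ ｛ B ｝
      only-B (inj₁ e)          = e
      only-B (inj₂ (D , e , _)) = ⊥-elim (∄D (D , e))

  refutation : ∀ {A} → (⊢ A → Empty) → ∃ λ w → A ∉ ⟦ w ⟧
  refutation ⊬A = world (isPrime e) , λ A∈ → consistent e (elem refl) (hyp (⟦world⟧⊆ (isPrime e) A∈))
    where
      e : PrimeExtension ∅ ｛ _ ｝
      e = lindenbaum (⊬⇒Consistent (⊬A ∘ ⊢-closed λ ()))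

  canonical : Frame
  canonical = record
    { W         = World
    ; inhabited = proj₁ (refutation ⊬⊥)
    ; _≤_       = λ w v → ⟦ w ⟧ ⊆′ ⟦ v ⟧
    ; ≤-refl    = λ _ → id
    ; ≤-trans   = λ w≤u u≤v A → u≤v A ∘ w≤u A
    ; R         = λ α w v → Rᶜ α ⟦ w ⟧ ⟦ v ⟧
    }

  open Frame canonical using (_≤_; R)

  ⇒-witness : ∀ w {A B} → A ⇒ B ∉ ⟦ w ⟧ → ∃ λ v → w ≤ v × A ∈ ⟦ v ⟧ × B ∉ ⟦ v ⟧
  ⇒-witness w {A} {B} A⇒B∉ =
    world pv , (λ _ → ⊆⟦world⟧ pv ∘ extends e ∘ inj₁) , ⊆⟦world⟧ pv (extends e (inj₂ refl)) ,
    consistent e (elem refl) ∘ hyp ∘ ⟦world⟧⊆ pv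
    where
      e : PrimeExtension (⟦ w ⟧ ∪ ｛ A ｝) ｛ B ｝
      e = lindenbaum (⊬⇒Consistent (A⇒B∉ ∘ World.closed w ∘ ⇒I))
      pv : PrimeTheory (theory e)
      pv = isPrime e

  □-witness : ∀ w {α A} → [ α ] A ∉ ⟦ w ⟧ → ∃₂ λ u v → w ≤ u × R α u v × A ∉ ⟦ v ⟧
  □-witness w {α} {A} □A∉ =
    world pu , world pv , (λ _ → ⊆⟦world⟧ pu ∘ extends e₁) ,
    Rᶜ-world pu pv (Rᶜ-extension {α} {theory e₁} id inj₂ e₂) ,
    consistent e₂ (elem (inj₁ refl)) ∘ hyp ∘ ⟦world⟧⊆ pv
    where
      e₁ : PrimeExtension ⟦ w ⟧ ｛ [ α ] A ｝
      e₁ = lindenbaum (⊬⇒Consistent (□A∉ ∘ World.closed w))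
      e₂ : PrimeExtension (□⁻¹ α (theory e₁)) (｛ A ｝ ∪ ∁ (◇⁻¹ α (theory e₁)))
      e₂ = lindenbaum (□-successor-consistent e₁)
      pu : PrimeTheory (theory e₁)
      pu = isPrime e₁
      pv : PrimeTheory (theory e₂)
      pv = isPrime e₂

  ◇-witness : ∀ w {α A} → ⟨ α ⟩ A ∈ ⟦ w ⟧ → ∃₂ λ u v → u ≤ w × R α u v × A ∈ ⟦ v ⟧
  ◇-witness w {α} {A} ◇A∈ =
    world pu , world pv , (λ _ B∈ → dne (disjoint e₁ (⟦world⟧⊆ pu B∈))) ,
    Rᶜ-world pu pv (Rᶜ-extension {α} {CompanionClosedExtension.theory e₁} inj₁ id e₂) ,
    ⊆⟦world⟧ pv (extends e₂ (inj₂ refl))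
    where
      open CompanionClosedExtension using (disjoint; companion-closed)
      open World w using (closed; Disj-∁)
      e₁ : CompanionClosedExtension ｛ ⟨ α ⟩ A ｝ (∁ ⟦ w ⟧) (◇-companion α A)
      e₁ = dual-lindenbaum (◇-companion α A) ◇-companion-consistent
             (λ δ t → Disj-∁ δ (closed (⊢-mono (λ { refl → ◇A∈ }) t)))
      pu : PrimeTheory (CompanionClosedExtension.theory e₁)
      pu = CompanionClosedExtension.isPrime e₁
      e₂ : PrimeExtension (□⁻¹ α (CompanionClosedExtension.theory e₁) ∪ ｛ A ｝)
                          (∁ (◇⁻¹ α (CompanionClosedExtension.theory e₁)))
      e₂ = lindenbaum (◇-successor-consistent pu (companion-closed e₁ (_ , refl , refl)))
      pv : PrimeTheory (theory e₂)
      pv = isPrime e₂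

  open Semantics n canonical using (_,_⊨_; Valid)

  valuation : Valuation canonical
  valuation = record { V = λ x w → var x ∈ ⟦ w ⟧ ; upward = λ x w≤v → w≤v (var x) }

  truth : ∀ A w → valuation , w ⊨ A ⇔ A ∈ ⟦ w ⟧
  truth (var x) w = ⇔-id _
  truth (A ⇒ B) w = mk⇔
    (λ f → dne λ A⇒B∉ → case ⇒-witness w A⇒B∉ of λ (v , w≤v , A∈ , B∉) →
      B∉ (to (truth B v) (f v w≤v (from (truth A v) A∈))))
    (λ A⇒B∈ v w≤v a → from (truth B v) (World.⇒-closed v (w≤v _ A⇒B∈) (to (truth A v) a)))
  truth ⊤ w = mk⇔ (λ _ → World.theorem∈ w (ipc ⊤i)) (λ _ → tt)
  truth ⊥ w = mk⇔ (λ ()) (⊥-elim ∘ World.⊥∉ w)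
  truth (A ∨ B) w = mk⇔
    [ (λ a → World.closed w (∨I₁ (hyp (to (truth A w) a))))
    , (λ b → World.closed w (∨I₂ (hyp (to (truth B w) b)))) ]′
    (Sum.map (from (truth A w)) (from (truth B w)) ∘ World.prime w)
  truth (A ∧ B) w = mk⇔
    (λ (a , b) → World.closed w (∧I (hyp (to (truth A w) a)) (hyp (to (truth B w) b))))
    (λ A∧B∈ → from (truth A w) (World.closed w (∧E₁ (hyp A∧B∈))) ,
              from (truth B w) (World.closed w (∧E₂ (hyp A∧B∈))))
  truth ([ α ] A) w = mk⇔
    (λ f → dne λ □A∉ → case □-witness w □A∉ of λ (u , v , w≤u , uRv , A∉) →
      A∉ (to (truth A v) (f u v w≤u uRv)))
    (λ □A∈ u v w≤u (□u⊆v , _) → from (truth A v) (□u⊆v (w≤u _ □A∈)))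
  truth (⟨ α ⟩ A) w = mk⇔
    (λ (u , v , u≤w , (_ , v⊆◇u) , a) → u≤w _ (v⊆◇u (to (truth A v) a)))
    (λ ◇A∈ → case ◇-witness w ◇A∈ of λ (u , v , u≤w , uRv , A∈) →
      u , v , u≤w , uRv , from (truth A v) A∈)

  completeness : ∀ {A} → Valid A → ⊢ A
  completeness {A} valid = dne λ ⊬A →
    let w , A∉ = refutation ⊬A in A∉ (to (truth A w) (valid valuation w))

  canonical-doxastic : (∀ α → ⊢ p ⇒ [ α ] p) → Doxastic canonical
  canonical-doxastic p⇒□p α w v (□w⊆v , _) A =
    □w⊆v ∘ World.⊢⇒-closed w (subst (pqr↦ A ⊤ ⊤) (p⇒□p α))

  canonical-serial : (∀ α → ⊢ [ α ] p ⇒ ¬ ¬ ⟨ α ⟩ p) → ∀ α w → ∃₂ λ u v → w ≤ u × R α u v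
  canonical-serial □p⇒¬¬◇p α w =
    case □-witness w □⊥∉ of λ (u , v , w≤u , uRv , _) → u , v , w≤u , uRv
    where
      □⊥∉ : [ α ] ⊥ ∉ ⟦ w ⟧
      □⊥∉ □⊥∈ = World.⊥∉ w (World.⇒-closed w (World.⊢⇒-closed w (subst (pqr↦ ⊥ ⊤ ⊤) (□p⇒¬¬◇p α)) □⊥∈)
                                              (World.theorem∈ w (modal (A4 α))))

  canonical-reflexive : (∀ α → ⊢ [ α ] p ⇒ p) → (∀ α → ⊢ p ⇒ ⟨ α ⟩ p) → ∀ α w → R α w w
  canonical-reflexive □p⇒p p⇒◇p α w =
    World.⊢⇒-closed w (subst (pqr↦ _ ⊤ ⊤) (□p⇒p α)) , World.⊢⇒-closed w (subst (pqr↦ _ ⊤ ⊤) (p⇒◇p α))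

  canonical-symmetric : (∀ α → ⊢ p ⇒ [ α ] ⟨ α ⟩ p) → (∀ α → ⊢ ⟨ α ⟩ [ α ] p ⇒ p) →
                        ∀ α w v → R α w v → R α v w
  canonical-symmetric p⇒□◇p ◇□p⇒p α w v (□w⊆v , v⊆◇w) =
    World.⊢⇒-closed w (subst (pqr↦ _ ⊤ ⊤) (◇□p⇒p α)) ∘ v⊆◇w ,
    □w⊆v ∘ World.⊢⇒-closed w (subst (pqr↦ _ ⊤ ⊤) (p⇒□◇p α))

module Unravelling (n : ℕ) (_≟_ : DecidableEquality (WithAgents.Group n)) (F : WithAgents.Frame n)
                   (R-reflexive : ∀ α s → WithAgents.Frame.R F α s s)
                   (R-symmetric : ∀ α s t → WithAgents.Frame.R F α s t → WithAgents.Frame.R F α t s) where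
  open WithAgents n hiding (_,_⊨_; ValidIn)
  open Frame F
  open Semantics n F using (_,_⊨_; Valid)

  record Lift : Set where
    field
      state       : W
      successor   : Group → W
      successor-R : ∀ β → R β state (successor β)

  open Lift

  -- Lifts are related when their α-edges (state , successor α) agree up to orientation: an
  -- equivalence relation, which by symmetry of R α still covers every R α-edge (along-R′).
  data R′ (α : Group) (x y : Lift) : Set where
    same     : state x ≡ state y → successor x α ≡ successor y α → R′ α x y
    reversed : state x ≡ successor y α → state y ≡ successor x α → R′ α x y

  stay : W → Lift
  stay s = record { state = s ; successor = λ _ → s ; successor-R = λ β → R-reflexive β s }

  along : ∀ {α u t} → R α u t → Lift
  along {α} {u} {t} uRt = record { state = u ; successor = target ; successor-R = target-R }
    where
      target : Group → W
      target β = if does (β ≟ α) then t else u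
      target-R : ∀ β → R β u (target β)
      target-R β with β ≟ α
      ... | yes refl = uRt
      ... | no _     = R-reflexive β u

  along-successor : ∀ {α u t} (uRt : R α u t) → successor (along uRt) α ≡ t
  along-successor {α} _ with α ≟ α
  ... | yes _   = refl
  ... | no α≢α = ⊥-elim (α≢α refl)

  state-R : ∀ {α y z} → R′ α y z → R α (state y) (state z)
  state-R {α} {y} (same e _)     = ≡.subst (R α (state y)) e (R-reflexive α (state y))
  state-R {α} {y} (reversed _ e) = ≡.subst (R α (state y)) (sym e) (successor-R y α)

  along-R′ : ∀ {α u t} (uRt : R α u t) → R′ α (along uRt) (along (R-symmetric α u t uRt))
  along-R′ uRt = reversed (sym (along-successor (R-symmetric _ _ _ uRt))) (sym (along-successor uRt))

  unravelled : Frame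
  unravelled = record
    { W         = Lift
    ; inhabited = stay inhabited
    ; _≤_       = λ x y → state x ≤ state y
    ; ≤-refl    = ≤-refl
    ; ≤-trans   = ≤-trans
    ; R         = R′
    }

  unravelled-partition : Partition unravelled
  unravelled-partition α = (λ _ → same refl refl) , R′-sym , R′-trans
    where
      R′-sym : ∀ x y → R′ α x y → R′ α y x
      R′-sym _ _ (same e₁ e₂)     = same (sym e₁) (sym e₂)
      R′-sym _ _ (reversed e₁ e₂) = reversed e₂ e₁
      R′-trans : ∀ x y z → R′ α x y → R′ α y z → R′ α x z
      R′-trans _ _ _ (same e₁ e₂)     (same e₃ e₄)     = same (trans e₁ e₃) (trans e₂ e₄)
      R′-trans _ _ _ (same e₁ e₂)     (reversed e₃ e₄) = reversed (trans e₁ e₃) (trans e₄ (sym e₂))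
      R′-trans _ _ _ (reversed e₁ e₂) (same e₃ e₄)     = reversed (trans e₁ e₄) (trans (sym e₃) e₂)
      R′-trans _ _ _ (reversed e₁ e₂) (reversed e₃ e₄) = same (trans e₁ (sym e₄)) (trans (sym e₂) e₃)

  open Semantics n unravelled using () renaming (_,_⊨_ to _,_⊨′_; Valid to Valid′)

  lift : Valuation F → Valuation unravelled
  lift M = record { V = λ x y → Valuation.V M x (state y) ; upward = λ x → Valuation.upward M x }

  lift-truth : ∀ M A x → M , state x ⊨ A ⇔ lift M , x ⊨′ A
  lift-truth M (var x) y = ⇔-id _
  lift-truth M (A ⇒ B) x = mk⇔
    (λ f y x≤y a → to (lift-truth M B y) (f (state y) x≤y (from (lift-truth M A y) a)))
    (λ f t x≤t a → from (lift-truth M B (stay t)) (f (stay t) x≤t (to (lift-truth M A (stay t)) a)))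
  lift-truth M ⊤ x = ⇔-id _
  lift-truth M ⊥ x = ⇔-id _
  lift-truth M (A ∨ B) x = lift-truth M A x ⊎-⇔ lift-truth M B x
  lift-truth M (A ∧ B) x = lift-truth M A x ×-⇔ lift-truth M B x
  lift-truth M ([ α ] A) x = mk⇔
    (λ f y z x≤y yR′z → to (lift-truth M A z) (f (state y) (state z) x≤y (state-R yR′z)))
    (λ f u t x≤u uRt → from (lift-truth M A (along (R-symmetric α u t uRt)))
      (f (along uRt) (along (R-symmetric α u t uRt)) x≤u (along-R′ uRt)))
  lift-truth M (⟨ α ⟩ A) x = mk⇔
    (λ (u , t , u≤x , uRt , a) → along uRt , along (R-symmetric α u t uRt) , u≤x , along-R′ uRt ,
      to (lift-truth M A (along (R-symmetric α u t uRt))) a)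
    (λ (y , z , y≤x , yR′z , a) → state y , state z , y≤x , state-R yR′z , from (lift-truth M A z) a)

  Valid′⇒Valid : ∀ {A} → Valid′ A → Valid A
  Valid′⇒Valid {A} valid M s = from (lift-truth M A (stay s)) (valid (lift M) (stay s))

module Adequacy (n : ℕ) (lem : ExcludedMiddle 0ℓ) where
  open WithAgents n

  Least⊆Log : ∀ {X C} → (∀ F → C F → X ⊆ ValidIn F) → ∀ A → Least X A → Log C A
  Least⊆Log X-valid A d F c = Semantics.soundness n F (X-valid F c) d

  point : Frame
  point = record
    { W = Unit ; inhabited = tt ; _≤_ = λ _ _ → Unit ; ≤-refl = tt ; ≤-trans = λ _ _ → tt
    ; R = λ _ _ _ → Unit }

  point-epistemic : Epistemic point
  point-epistemic = (λ _ _ _ _ → tt) , (λ _ _ → tt , tt , tt , tt)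

  point-partition : Partition point
  point-partition _ = (λ _ → tt) , (λ _ _ _ → tt) , (λ _ _ _ _ _ → tt)

  ⊬⊥ : ∀ {X} → X ⊆ ValidIn point → Least X ⊥ → Empty
  ⊬⊥ X-valid d =
    Semantics.soundness n point X-valid d (record { V = λ _ _ → Unit ; upward = λ _ _ _ → tt }) tt

  module Cᵃ = Canonical n lem Xall (⊬⊥ λ ())
  module Cᵈ = Canonical n lem Xdox (⊬⊥ (Semantics.Xdox-valid n point (proj₁ point-epistemic)))
  module Cᵉ = Canonical n lem Xepi (⊬⊥ (Semantics.Xepi-valid n point point-epistemic))
  module Cᵖ = Canonical n lem Xpar (⊬⊥ (Semantics.Xpar-valid n point point-partition))
  module Uᵖ = Unravelling n (λ _ _ → lem) Cᵖ.canonical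
                (Cᵖ.canonical-reflexive (extra ∘ T□) (extra ∘ T◇))
                (Cᵖ.canonical-symmetric (extra ∘ B□) (extra ∘ B◇))

  Lall-adequate : Lall ≐ Log Call
  Lall-adequate = Least⊆Log (λ _ _ ()) , λ _ valid → Cᵃ.completeness (valid Cᵃ.canonical tt)

  Ldox-adequate : Ldox ≐ Log Cdox
  Ldox-adequate = Least⊆Log (Semantics.Xdox-valid n) , λ _ valid →
    Cᵈ.completeness (valid Cᵈ.canonical (Cᵈ.canonical-doxastic (extra ∘ A6)))

  Lepi-adequate : Lepi ≐ Log Cepi
  Lepi-adequate = Least⊆Log (Semantics.Xepi-valid n) , λ _ valid →
    Cᵉ.completeness
      (valid Cᵉ.canonical (Cᵉ.canonical-doxastic (extra ∘ A6) , Cᵉ.canonical-serial (extra ∘ A7)))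

  Lpar-adequate : Lpar ≐ Log Cpar
  Lpar-adequate = Least⊆Log (Semantics.Xpar-valid n) , λ A valid →
    Cᵖ.completeness (Uᵖ.Valid′⇒Valid {A} (valid Uᵖ.unravelled Uᵖ.unravelled-partition))

proposition27 : (n : ℕ) → ExcludedMiddle 0ℓ →
    let open WithAgents n in
    (Lall ≐ Log Call) × (Ldox ≐ Log Cdox) × (Lepi ≐ Log Cepi) × (Lpar ≐ Log Cpar)
proposition27 n lem = Lall-adequate , Ldox-adequate , Lepi-adequate , Lpar-adequate
  where open Adequacy n lem
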